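{- Let $T$ be a pattern-tree and let $\pi\in\mathbb{S}_n$. Then \[ \#T(\pi) = \sum_{E \supseteq E^T}\ \sum_{\sigma \in \mathcal{L}(\mathcal{P}_x^{E}),\ \tau \in \mathcal{L}(\mathcal{P}_y^{E})} \#\left(\tau \sigma^{ -1}\right)(\pi), \] where $E$ ranges over all equivalence relations on $p(T)$ that contain $E^T$, and each pattern $\tau\sigma^{ -1}$ appearing has size $|E|\le \Sigma(T)$.
   Context: For $\rho\in\mathbb{S}_k$ and $\pi\in\mathbb{S}_n$, $\#\rho(\pi)$ is the number of $k$-tuples $1\le i_1<\dots<i_k\le n$ with $\pi(i_j)<\pi(i_l)$ iff $\rho(j)<\rho(l)$. The points of $\pi$ are $p(\pi)=\{(i,\pi(i)):i\in[n]\}$. A pattern-tree $T$ is a rooted tree (edges oriented away from the root) where each vertex $v$ is labeled by a permutation $\tau_v\in\mathbb{S}_r$ ($r=s(v)\ge1$, the size of $v$) and is assigned fresh variables $x_v^1,\dots,x_v^r,y_v^1,\dots,y_v^r$, with points $p_v^i=(x_v^i,y_v^i)$ and $p_v=\{p_v^1,\dots,p_v^r\}$; each edge $u\to v$ is labeled by two strict posets $\mathcal{P}^x_{uv}$ on $x_u\sqcup x_v$ and $\mathcal{P}^y_{uv}$ on $y_u\sqcup y_v$, and a set $E_{uv}\subseteq p_u\times p_v$ of equalities. Let $p(T)=\bigsqcup_v p_v$ and $\Sigma(T)=\sum_v s(v)$. The constraints of $T$ are: for every vertex $v$, $x_v^1<\dots<x_v^r$ and $y_v^i<y_v^j$ whenever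 $\tau_v(i)<\tau_v(j)$; for every edge, the inequalities of $\mathcal{P}^x_{uv},\mathcal{P}^y_{uv}$ and the point equalities in $E_{uv}$. The inequalities form strict posets $\mathcal{P}^T_x$ on all $x$-variables and $\mathcal{P}^T_y$ on all $y$-variables; $E^T$ is the equivalence relation on $p(T)$ generated by all $E_{uv}$. An occurrence of $T$ in $\pi$ is a map $\varphi:p(T)\to p(\pi)$ (not necessarily injective) such that assigning to each point variable the coordinates of its image satisfies all constraints; $\#T(\pi)$ is the number of occurrences. For an equivalence relation $E\supseteq E^T$ on $p(T)$ with $k=|E|$ classes (fix an arbitrary order of the classes $1,\dots,k$), $\mathcal{P}^E_x$ (resp. $\mathcal{P}^E_y$) is the relation on the $k$ classes obtained from $\mathcal{P}^T_x$ (resp. $\mathcal{P}^T_y$) by replacing each coordinate variable with the class of its point. $\mathcal{L}(\mathcal{P})$ is the set of linear extensions, where a linear extension is identified with the permutation $\sigma\in\mathbb{S}_k$ assigning to class $i$ the rank $\sigma(i)$ (so $\mathcal{L}$ is empty if the relation is not consistent with any total order). -}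

module Defs where

open import Data.Nat using (ℕ; zero; suc; _<ᵇ_; _≡ᵇ_; _≤_)
open import Data.Bool using (Bool; true; false; _∧_; _∨_; not; if_then_else_)
open import Data.Fin using (Fin; toℕ) renaming (zero to fz; suc to fs)
open import Data.Fin.Permutation using (Permutation′; _⟨$⟩ʳ_)
open import Data.List using (List; []; _∷_; map; concatMap; allFin; filter; length; foldr)
open import Data.Nat.ListAction using (sum)
open import Data.Product using (Σ; _,_; proj₁; proj₂; _×_)
open import Data.Sum using (_⊎_; inj₁; inj₂)
open import Relation.Binary.PropositionalEquality using (_≡_)
open import Function using (_∘_; _⇔_)

allB : {A : Set} → List A → (A → Bool) → Bool
allB xs p = foldr (λ x b → p x ∧ b) true xs

anyB : {A : Set} → List A → (A → Bool) → Bool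
anyB xs p = foldr (λ x b → p x ∨ b) false xs

count : {A : Set} → List A → (A → Bool) → ℕ
count xs p = foldr (λ x c → if p x then suc c else c) 0 xs

sumIf : {A : Set} → List A → (A → Bool) → (A → ℕ) → ℕ
sumIf xs p f = foldr (λ x c → if p x then f x Data.Nat.+ c else c) 0 xs

_⇒ᵇ_ : Bool → Bool → Bool
a ⇒ᵇ b = not a ∨ b

finEq : {k : ℕ} → Fin k → Fin k → Bool
finEq i j = toℕ i ≡ᵇ toℕ j

finLt : {k : ℕ} → Fin k → Fin k → Bool
finLt i j = toℕ i <ᵇ toℕ j

depFuns : (k : ℕ) (B : Fin k → Set) → ((i : Fin k) → List (B i)) → List ((i : Fin k) → B i)
depFuns zero B e = (λ ()) ∷ []
depFuns (suc k) B e =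
  concatMap (λ b → map (λ f → cons b f) (depFuns k (B ∘ fs) (e ∘ fs))) (e fz)
  where
  cons : B fz → ((i : Fin k) → B (fs i)) → (i : Fin (suc k)) → B i
  cons b f fz = b
  cons b f (fs i) = f i

finFuns : (k n : ℕ) → List (Fin k → Fin n)
finFuns k n = depFuns k (λ _ → Fin n) (λ _ → allFin n)

isBijB : {k : ℕ} → (Fin k → Fin k) → Bool
isBijB {k} f =
  allB (allFin k) (λ i → allB (allFin k) (λ j → finEq (f i) (f j) ⇒ᵇ finEq i j))
  ∧ allB (allFin k) (λ y → anyB (allFin k) (λ x → finEq (f x) y))

Sym : (k : ℕ) → List (Fin k → Fin k)
Sym k = filter (λ f → isBijB f Data.Bool.≟ true) (finFuns k k)

-- inverse of a bijection of Fin k (found by search; the fallback is never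
-- used when f is a bijection)
findPre : {k : ℕ} → (Fin k → Fin k) → Fin k → List (Fin k) → Fin k
findPre f y [] = y
findPre f y (x ∷ xs) = if finEq (f x) y then x else findPre f y xs

inv : {k : ℕ} → (Fin k → Fin k) → Fin k → Fin k
inv {k} f y = findPre f y (allFin k)

occ : {k n : ℕ} → (Fin k → Fin k) → (Fin n → Fin n) → ℕ
occ {k} {n} ρ π = count (finFuns k n) λ i →
  allB (allFin k) λ j → allB (allFin k) λ l →
    (finLt j l ⇒ᵇ finLt (i j) (i l))
    ∧ ((finLt (π (i j)) (π (i l)) ⇒ᵇ finLt (ρ j) (ρ l))
       ∧ (finLt (ρ j) (ρ l) ⇒ᵇ finLt (π (i j)) (π (i l))))

-- Vertices are Fin (suc m), the root is vertex 0, and the non-root vertices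
-- are fs e for e : Fin m.  Each non-root vertex fs e has a parent
-- `parent e` with a smaller index; the edge e is  parent e → fs e.
-- (Every finite rooted tree can be so numbered, e.g. in BFS order.)

record PatternTree : Set where
  field
    m       : ℕ
    parent  : Fin m → Fin (suc m)
    parent< : (e : Fin m) → suc (toℕ (parent e)) ≤ toℕ (fs e)
    s       : Fin (suc m) → ℕ
    s≥1     : (v : Fin (suc m)) → 1 ≤ s v
    τ       : (v : Fin (suc m)) → Permutation′ (s v)
    -- edge labels: strict posets on x_u ⊔ x_v and y_u ⊔ y_v
    -- (inj₁ i stands for x_u^i / y_u^i, inj₂ j for x_v^j / y_v^j)
    Px      : (e : Fin m) → Fin (s (parent e)) ⊎ Fin (s (fs e))
                          → Fin (s (parent e)) ⊎ Fin (s (fs e)) → Bool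
    Py      : (e : Fin m) → Fin (s (parent e)) ⊎ Fin (s (fs e))
                          → Fin (s (parent e)) ⊎ Fin (s (fs e)) → Bool
    Px-irr  : ∀ e a → Px e a a ≡ false
    Px-tr   : ∀ e a b c → Px e a b ≡ true → Px e b c ≡ true → Px e a c ≡ true
    Py-irr  : ∀ e a → Py e a a ≡ false
    Py-tr   : ∀ e a b c → Py e a b ≡ true → Py e b c ≡ true → Py e a c ≡ true
    -- equalities E_uv ⊆ p_u × p_v  (Eq e i j = true means p_u^i = p_v^j)
    Eq      : (e : Fin m) → Fin (s (parent e)) → Fin (s (fs e)) → Bool

module _ (T : PatternTree) where
  open PatternTree T

  -- the points p(T) = ⊔_v p_v ; the point p_v^i is (v , i)
  Pt : Set
  Pt = Σ (Fin (suc m)) (λ v → Fin (s v))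

  allPt : List Pt
  allPt = concatMap (λ v → map (λ i → (v , i)) (allFin (s v))) (allFin (suc m))

  ΣT : ℕ
  ΣT = sum (map s (allFin (suc m)))

  emb : (e : Fin m) → Fin (s (parent e)) ⊎ Fin (s (fs e)) → Pt
  emb e (inj₁ i) = (parent e , i)
  emb e (inj₂ j) = (fs e , j)

  sides : (e : Fin m) → List (Fin (s (parent e)) ⊎ Fin (s (fs e)))
  sides e = map inj₁ (allFin (s (parent e))) Data.List.++ map inj₂ (allFin (s (fs e)))

  -- X satisfies all x-inequalities of T (i.e. the relation P^T_x), where
  -- X assigns a value to the x-coordinate variable of each point
  satX : (Pt → ℕ) → Bool
  satX X =
    allB (allFin (suc m)) (λ v → allB (allFin (s v)) λ i → allB (allFin (s v)) λ j →
      finLt i j ⇒ᵇ (X (v , i) <ᵇ X (v , j)))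
    ∧ allB (allFin m) (λ e → allB (sides e) λ a → allB (sides e) λ b →
      Px e a b ⇒ᵇ (X (emb e a) <ᵇ X (emb e b)))

  satY : (Pt → ℕ) → Bool
  satY Y =
    allB (allFin (suc m)) (λ v → allB (allFin (s v)) λ i → allB (allFin (s v)) λ j →
      finLt (τ v ⟨$⟩ʳ i) (τ v ⟨$⟩ʳ j) ⇒ᵇ (Y (v , i) <ᵇ Y (v , j)))
    ∧ allB (allFin m) (λ e → allB (sides e) λ a → allB (sides e) λ b →
      Py e a b ⇒ᵇ (Y (emb e a) <ᵇ Y (emb e b)))

  satEq : (Pt → Pt → Bool) → Bool
  satEq R = allB (allFin m) λ e →
    allB (allFin (s (parent e))) λ i → allB (allFin (s (fs e))) λ j →
      Eq e i j ⇒ᵇ R (parent e , i) (fs e , j)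

  -- #T(π): maps φ : p(T) → p(π), with φ(a) = (φ a , π(φ a))
  occT : {n : ℕ} → Permutation′ n → ℕ
  occT {n} π = count (depFuns (suc m) (λ v → Fin (s v) → Fin n)
                        (λ v → finFuns (s v) n)) λ φ →
    let X : Pt → ℕ
        X a = toℕ (φ (proj₁ a) (proj₂ a))
        Y : Pt → ℕ
        Y a = toℕ (π ⟨$⟩ʳ φ (proj₁ a) (proj₂ a))
    in satX X ∧ satY Y ∧ satEq (λ a b → (X a ≡ᵇ X b) ∧ (Y a ≡ᵇ Y b))

  allRel : List (Pt → Pt → Bool)
  allRel = map (λ f a → f (proj₁ a) (proj₂ a))
    (depFuns (suc m) (λ v → Fin (s v) → Pt → Bool)
      (λ v → depFuns (s v) (λ _ → Pt → Bool) (λ _ → predPt)))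
    where
    predPt : List (Pt → Bool)
    predPt = map (λ f a → f (proj₁ a) (proj₂ a))
      (depFuns (suc m) (λ v → Fin (s v) → Bool)
        (λ v → depFuns (s v) (λ _ → Bool) (λ _ → true ∷ false ∷ [])))

  ptEq : Pt → Pt → Bool
  ptEq (v , i) (w , j) = finEq v w ∧ (toℕ i ≡ᵇ toℕ j)

  isEquivB : (Pt → Pt → Bool) → Bool
  isEquivB E =
    allB allPt (λ a → E a a)
    ∧ allB allPt (λ a → allB allPt λ b → E a b ⇒ᵇ E b a)
    ∧ allB allPt (λ a → allB allPt λ b → allB allPt λ c → (E a b ∧ E b c) ⇒ᵇ E a c)

  validE : (Pt → Pt → Bool) → Bool
  validE E = isEquivB E ∧ satEq E

  -- an ordering of the classes of E: c maps each point to the index of its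
  -- class among k = |E| classes (c surjective, c a = c b iff a E b)
  IsClassing : (Pt → Pt → Bool) → Σ ℕ (λ k → Pt → Fin k) → Set
  IsClassing E (k , c) =
    ((y : Fin k) → Σ Pt (λ a → c a ≡ y))
    × ((a b : Pt) → (c a ≡ c b) ⇔ (E a b ≡ true))

  -- σ ∈ L(P^E_x): replacing each x-variable with (the rank σ of) its class
  -- satisfies all x-inequalities
  linExtX : {k : ℕ} → (Pt → Fin k) → (Fin k → Fin k) → Bool
  linExtX c σ = satX (λ a → toℕ (σ (c a)))

  linExtY : {k : ℕ} → (Pt → Fin k) → (Fin k → Fin k) → Bool
  linExtY c τ' = satY (λ a → toℕ (τ' (c a)))

  innerSum : {n : ℕ} → Permutation′ n → Σ ℕ (λ k → Pt → Fin k) → ℕ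
  innerSum π (k , c) =
    sumIf (Sym k) (linExtX c) λ σ →
      sumIf (Sym k) (linExtY c) λ τ' →
        occ (τ' ∘ inv σ) (π ⟨$⟩ʳ_)

-- Expand each #(τσ⁻¹)(π) on the right as a sum over occurrences i of τσ⁻¹, and read the triple
-- (σ, τ, i) as the map φ = i ∘ σ ∘ c from p(T) to p(π), c sending a point to its E-class. Then φ
-- is an occurrence of T whose kernel (the pairs of points with the same image) is exactly E.
-- Conversely an occurrence φ of T arises only from E = ker φ, and there from exactly one triple.
-- So both sides count the occurrences of T.  The bound |E| ≤ Σ(T) holds because c maps the
-- Σ(T) points of T onto the classes.
module Submission where

open import Defs
open import Data.Nat using (ℕ; zero; suc; _+_; _*_; _≤_; _<_; _<ᵇ_; _≡ᵇ_; z≤n; s≤s)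
import Data.Nat.Properties as ℕₚ
open import Data.Nat.ListAction using (sum)
open import Data.Bool using (Bool; true; false; _∧_; _∨_; not)
import Data.Bool as Bool
open import Data.Bool.Properties using (T-≡)
open import Data.Fin using (Fin; toℕ; fromℕ<; punchOut) renaming (zero to fz; suc to fs)
import Data.Fin.Properties as Finₚ
open import Data.Fin.Permutation using (Permutation′; _⟨$⟩ʳ_; _⟨$⟩ˡ_; inverseˡ)
open import Data.List using (List; []; _∷_; map; concatMap; allFin; filter; foldr; tabulate; _++_)
open import Data.List.Properties using (map-tabulate)
open import Data.Product using (Σ; ∃₂; _×_; _,_; proj₁; proj₂)
open import Data.Empty using (⊥-elim)
open import Relation.Binary.PropositionalEquality
  using (_≡_; _≢_; refl; sym; trans; cong; cong₂; subst; subst₂; module ≡-Reasoning)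
open import Relation.Nullary using (¬_; yes; no)
open import Relation.Binary using (tri<; tri≈; tri>)
open import Function using (_∘_; id; Equivalence)
open import Function.Definitions using (Injective)
open import Algebra.Properties.CommutativeSemigroup ℕₚ.+-commutativeSemigroup using (interchange)

∑ : {A : Set} → List A → (A → ℕ) → ℕ
∑ xs f = foldr (λ x acc → f x + acc) 0 xs

𝟙 : Bool → ℕ
𝟙 true = 1
𝟙 false = 0

_⊙_ : Bool → ℕ → ℕ
true ⊙ x = x
false ⊙ x = 0

infixr 7 _⊙_

module _ {A : Set} where

  count≡∑𝟙 : (xs : List A) (p : A → Bool) → count xs p ≡ ∑ xs (𝟙 ∘ p)
  count≡∑𝟙 [] p = refl
  count≡∑𝟙 (x ∷ xs) p with p x
  ... | true = cong suc (count≡∑𝟙 xs p)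
  ... | false = count≡∑𝟙 xs p

  sumIf≡∑⊙ : (xs : List A) (p : A → Bool) (f : A → ℕ) → sumIf xs p f ≡ ∑ xs (λ x → p x ⊙ f x)
  sumIf≡∑⊙ [] p f = refl
  sumIf≡∑⊙ (x ∷ xs) p f with p x
  ... | true = cong (f x +_) (sumIf≡∑⊙ xs p f)
  ... | false = sumIf≡∑⊙ xs p f

  ∑-filter : (p : A → Bool) (xs : List A) (f : A → ℕ) →
             ∑ (filter (λ x → p x Bool.≟ true) xs) f ≡ ∑ xs (λ x → p x ⊙ f x)
  ∑-filter p [] f = refl
  ∑-filter p (x ∷ xs) f with p x
  ... | true = cong (f x +_) (∑-filter p xs f)
  ... | false = ∑-filter p xs f

  ∑-cong : (xs : List A) {f g : A → ℕ} → (∀ x → f x ≡ g x) → ∑ xs f ≡ ∑ xs g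
  ∑-cong [] h = refl
  ∑-cong (x ∷ xs) h = cong₂ _+_ (h x) (∑-cong xs h)

  ∑-zero : (xs : List A) {f : A → ℕ} → (∀ x → f x ≡ 0) → ∑ xs f ≡ 0
  ∑-zero [] h = refl
  ∑-zero (x ∷ xs) h rewrite h x = ∑-zero xs h

  ∑-mono : (xs : List A) {f g : A → ℕ} → (∀ x → f x ≤ g x) → ∑ xs f ≤ ∑ xs g
  ∑-mono [] h = z≤n
  ∑-mono (x ∷ xs) h = ℕₚ.+-mono-≤ (h x) (∑-mono xs h)

  ∑-distrib-+ : (xs : List A) (f g : A → ℕ) → ∑ xs (λ x → f x + g x) ≡ ∑ xs f + ∑ xs g
  ∑-distrib-+ [] f g = refl
  ∑-distrib-+ (x ∷ xs) f g = trans (cong ((f x + g x) +_) (∑-distrib-+ xs f g))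
                                   (interchange (f x) (g x) (∑ xs f) (∑ xs g))

  ⊙-distrib-∑ : ∀ b (xs : List A) (f : A → ℕ) → b ⊙ ∑ xs f ≡ ∑ xs (λ x → b ⊙ f x)
  ⊙-distrib-∑ true xs f = refl
  ⊙-distrib-∑ false xs f = sym (∑-zero xs (λ _ → refl))

  ∑-++ : (xs ys : List A) (f : A → ℕ) → ∑ (xs ++ ys) f ≡ ∑ xs f + ∑ ys f
  ∑-++ [] ys f = refl
  ∑-++ (x ∷ xs) ys f = trans (cong (f x +_) (∑-++ xs ys f)) (sym (ℕₚ.+-assoc (f x) (∑ xs f) (∑ ys f)))

∑-comm : {A B : Set} (xs : List A) (ys : List B) (f : A → B → ℕ) →
         ∑ xs (λ x → ∑ ys (f x)) ≡ ∑ ys (λ y → ∑ xs (λ x → f x y))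
∑-comm [] ys f = sym (∑-zero ys (λ _ → refl))
∑-comm (x ∷ xs) ys f = trans (cong (∑ ys (f x) +_) (∑-comm xs ys f))
                             (sym (∑-distrib-+ ys (f x) (λ y → ∑ xs (λ x → f x y))))

∑-map : {A B : Set} (g : A → B) (xs : List A) (f : B → ℕ) → ∑ (map g xs) f ≡ ∑ xs (f ∘ g)
∑-map g [] f = refl
∑-map g (x ∷ xs) f = cong (f (g x) +_) (∑-map g xs f)

∑-concatMap : {A B : Set} (g : A → List B) (xs : List A) (f : B → ℕ) →
              ∑ (concatMap g xs) f ≡ ∑ xs (λ x → ∑ (g x) f)
∑-concatMap g [] f = refl
∑-concatMap g (x ∷ xs) f = trans (∑-++ (g x) (concatMap g xs) f) (cong (∑ (g x) f +_) (∑-concatMap g xs f))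

∧-elimˡ : ∀ {a b} → a ∧ b ≡ true → a ≡ true
∧-elimˡ {true} _ = refl

∧-elimʳ : ∀ {a b} → a ∧ b ≡ true → b ≡ true
∧-elimʳ {true} e = e

∧-intro : ∀ {a b} → a ≡ true → b ≡ true → a ∧ b ≡ true
∧-intro refl refl = refl

⇒ᵇ-elim : ∀ {a b} → (a ⇒ᵇ b) ≡ true → a ≡ true → b ≡ true
⇒ᵇ-elim {true} e refl = e

⇒ᵇ-intro : ∀ {a b} → (a ≡ true → b ≡ true) → (a ⇒ᵇ b) ≡ true
⇒ᵇ-intro {true} h = h refl
⇒ᵇ-intro {false} h = refl

⇒ᵇ-mono : ∀ {a b b′} → (b ≡ true → b′ ≡ true) → (a ⇒ᵇ b) ≡ true → (a ⇒ᵇ b′) ≡ true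
⇒ᵇ-mono h e = ⇒ᵇ-intro (h ∘ ⇒ᵇ-elim e)

Bool-ext : ∀ {a b} → (a ≡ true → b ≡ true) → (b ≡ true → a ≡ true) → a ≡ b
Bool-ext {true} f g = sym (f refl)
Bool-ext {false} {true} f g = g refl
Bool-ext {false} {false} f g = refl

⊙-∧ : ∀ a b x → (a ∧ b) ⊙ x ≡ a ⊙ b ⊙ x
⊙-∧ true b x = refl
⊙-∧ false b x = refl

𝟙-∧ : ∀ a b → 𝟙 (a ∧ b) ≡ a ⊙ 𝟙 b
𝟙-∧ true b = refl
𝟙-∧ false b = refl

⊙-1 : ∀ b → b ⊙ 1 ≡ 𝟙 b
⊙-1 true = refl
⊙-1 false = refl

module _ {A : Set} where

  allB-intro : (xs : List A) {P : A → Bool} → (∀ x → P x ≡ true) → allB xs P ≡ true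
  allB-intro [] h = refl
  allB-intro (x ∷ xs) h = ∧-intro (h x) (allB-intro xs h)

  allB-mono : (xs : List A) {P Q : A → Bool} → (∀ x → P x ≡ true → Q x ≡ true) →
              allB xs P ≡ true → allB xs Q ≡ true
  allB-mono [] h e = refl
  allB-mono (x ∷ xs) h e = ∧-intro (h x (∧-elimˡ e)) (allB-mono xs h (∧-elimʳ e))

  allB-cong : (xs : List A) {P Q : A → Bool} → (∀ x → P x ≡ Q x) → allB xs P ≡ allB xs Q
  allB-cong [] h = refl
  allB-cong (x ∷ xs) h = cong₂ _∧_ (h x) (allB-cong xs h)

allB-map : {A B : Set} (g : A → B) (xs : List A) (P : B → Bool) → allB (map g xs) P ≡ allB xs (P ∘ g)
allB-map g [] P = refl
allB-map g (x ∷ xs) P = cong (P (g x) ∧_) (allB-map g xs P)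

allFin-suc : ∀ k → allFin (suc k) ≡ fz ∷ map fs (allFin k)
allFin-suc k = cong (fz ∷_) (sym (map-tabulate id fs))

allB-allFin-suc : ∀ {k} (P : Fin (suc k) → Bool) → allB (allFin (suc k)) P ≡ P fz ∧ allB (allFin k) (P ∘ fs)
allB-allFin-suc {k} P = trans (cong (λ xs → allB xs P) (allFin-suc k)) (cong (P fz ∧_) (allB-map fs (allFin k) P))

allB-allFin-elim : ∀ {k} {P : Fin k → Bool} → allB (allFin k) P ≡ true → ∀ j → P j ≡ true
allB-allFin-elim e fz = ∧-elimˡ e
allB-allFin-elim {P = P} e (fs j) = allB-allFin-elim (∧-elimʳ (trans (sym (allB-allFin-suc P)) e)) j

≡ᵇ⇒≡ : ∀ {a b} → (a ≡ᵇ b) ≡ true → a ≡ b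
≡ᵇ⇒≡ {a} {b} e = ℕₚ.≡ᵇ⇒≡ a b (Equivalence.from T-≡ e)

≡⇒≡ᵇ : ∀ {a b} → a ≡ b → (a ≡ᵇ b) ≡ true
≡⇒≡ᵇ {a} {b} e = Equivalence.to T-≡ (ℕₚ.≡⇒≡ᵇ a b e)

≡ᵇ-refl : ∀ a → (a ≡ᵇ a) ≡ true
≡ᵇ-refl a = ≡⇒≡ᵇ {a} refl

<ᵇ⇒< : ∀ {a b} → (a <ᵇ b) ≡ true → a < b
<ᵇ⇒< {a} {b} e = ℕₚ.<ᵇ⇒< a b (Equivalence.from T-≡ e)

<⇒<ᵇ : ∀ {a b} → a < b → (a <ᵇ b) ≡ true
<⇒<ᵇ p = Equivalence.to T-≡ (ℕₚ.<⇒<ᵇ p)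

<ᵇ-irrefl : ∀ a → (a <ᵇ a) ≡ false
<ᵇ-irrefl zero = refl
<ᵇ-irrefl (suc a) = <ᵇ-irrefl a

finEq⇒≡ : ∀ {k} {a b : Fin k} → finEq a b ≡ true → a ≡ b
finEq⇒≡ e = Finₚ.toℕ-injective (≡ᵇ⇒≡ e)

≡⇒finEq : ∀ {k} {a b : Fin k} → a ≡ b → finEq a b ≡ true
≡⇒finEq e = ≡⇒≡ᵇ (cong toℕ e)

∑-allFin-suc : ∀ {k} (f : Fin (suc k) → ℕ) → ∑ (allFin (suc k)) f ≡ f fz + ∑ (allFin k) (f ∘ fs)
∑-allFin-suc {k} f = trans (cong (λ xs → ∑ xs f) (allFin-suc k)) (cong (f fz +_) (∑-map fs (allFin k) f))

∑-allFin-≥ : ∀ {k} (f : Fin k → ℕ) j → f j ≤ ∑ (allFin k) f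
∑-allFin-≥ f fz = ℕₚ.m≤m+n _ _
∑-allFin-≥ f (fs j) = ℕₚ.≤-trans (ℕₚ.≤-trans (∑-allFin-≥ (f ∘ fs) j) (ℕₚ.m≤n+m _ (f fz)))
                               (ℕₚ.≤-reflexive (sym (∑-allFin-suc f)))

∑-allFin-1 : ∀ k → ∑ (allFin k) (λ _ → 1) ≡ k
∑-allFin-1 zero = refl
∑-allFin-1 (suc k) = trans (∑-allFin-suc {k} (λ _ → 1)) (cong suc (∑-allFin-1 k))

∑-allFin-finEq : ∀ {k} (x : Fin k) → ∑ (allFin k) (λ l → 𝟙 (finEq l x)) ≡ 1
∑-allFin-finEq {suc k} x = trans (∑-allFin-suc (λ l → 𝟙 (finEq l x))) (lemma x)
  where
  lemma : (x : Fin (suc k)) → 𝟙 (finEq fz x) + ∑ (allFin k) (λ l → 𝟙 (finEq (fs l) x)) ≡ 1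
  lemma fz = cong suc (∑-zero (allFin k) (λ _ → refl))
  lemma (fs x) = ∑-allFin-finEq x

∑𝟙-split : ∀ {A : Set} (xs : List A) (p q : A → Bool) → (∀ x → p x ≡ true → q x ≡ true) →
           ∑ xs (𝟙 ∘ q) ≡ ∑ xs (𝟙 ∘ p) + ∑ xs (λ x → 𝟙 (q x ∧ not (p x)))
∑𝟙-split xs p q p⊆q = trans (∑-cong xs (λ x → split (p x) (q x) (p⊆q x))) (∑-distrib-+ xs _ _)
  where
  split : ∀ a b → (a ≡ true → b ≡ true) → 𝟙 b ≡ 𝟙 a + 𝟙 (b ∧ not a)
  split true true _ = refl
  split true false h with () ← h refl
  split false true _ = refl
  split false false _ = refl

∑𝟙-<-allFin : ∀ {k} (p q : Fin k → Bool) → (∀ x → p x ≡ true → q x ≡ true) →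
              ∀ j → q j ≡ true → p j ≡ false → ∑ (allFin k) (𝟙 ∘ p) < ∑ (allFin k) (𝟙 ∘ q)
∑𝟙-<-allFin {k} p q p⊆q j qj pj = begin-strict
  ∑ (allFin k) (𝟙 ∘ p)                     <⟨ ℕₚ.m<m+n _ (s≤s z≤n) ⟩
  ∑ (allFin k) (𝟙 ∘ p) + 1                 ≤⟨ ℕₚ.+-monoʳ-≤ (∑ (allFin k) (𝟙 ∘ p)) q∖p-nonempty ⟩
  ∑ (allFin k) (𝟙 ∘ p) + ∑ (allFin k) q∖p  ≡⟨ sym (∑𝟙-split (allFin k) p q p⊆q) ⟩
  ∑ (allFin k) (𝟙 ∘ q)                     ∎
  where
  open ℕₚ.≤-Reasoning
  q∖p : Fin k → ℕ
  q∖p x = 𝟙 (q x ∧ not (p x))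
  in-q∖p : ∀ {a b} → a ≡ true → b ≡ false → a ∧ not b ≡ true
  in-q∖p refl refl = refl
  q∖p-nonempty : 1 ≤ ∑ (allFin k) q∖p
  q∖p-nonempty = subst (λ b → 𝟙 b ≤ ∑ (allFin k) q∖p) (in-q∖p qj pj) (∑-allFin-≥ q∖p j)

depFuns-unique : (k : ℕ) (B : Fin k → Set) (e : (i : Fin k) → List (B i)) (q : (i : Fin k) → B i → Bool) →
                 ((i : Fin k) → ∑ (e i) (𝟙 ∘ q i) ≡ 1) →
                 ∑ (depFuns k B e) (λ f → 𝟙 (allB (allFin k) (λ i → q i (f i)))) ≡ 1
depFuns-unique zero B e q h = refl
depFuns-unique (suc k) B e q h = begin
  ∑ (depFuns (suc k) B e) (λ f → 𝟙 (allB (allFin (suc k)) (λ i → q i (f i))))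
    ≡⟨ ∑-cong (depFuns (suc k) B e) (λ f →
         trans (cong 𝟙 (allB-allFin-suc (λ i → q i (f i)))) (𝟙-∧ (q fz (f fz)) _)) ⟩
  ∑ (depFuns (suc k) B e) (λ f → q fz (f fz) ⊙ 𝟙 (allB (allFin k) (λ i → q (fs i) (f (fs i)))))
    ≡⟨ trans (∑-concatMap _ (e fz) _) (∑-cong (e fz) λ b → ∑-map _ tails _) ⟩
  ∑ (e fz) (λ b → ∑ tails (λ f → q fz b ⊙ 𝟙 (allB (allFin k) (λ i → q (fs i) (f i)))))
    ≡⟨ ∑-cong (e fz) (λ b → sym (⊙-distrib-∑ (q fz b) tails _)) ⟩
  ∑ (e fz) (λ b → q fz b ⊙ ∑ tails (λ f → 𝟙 (allB (allFin k) (λ i → q (fs i) (f i)))))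
    ≡⟨ ∑-cong (e fz) (λ b →
         trans (cong (q fz b ⊙_) (depFuns-unique k (B ∘ fs) (e ∘ fs) (q ∘ fs) (h ∘ fs))) (⊙-1 (q fz b))) ⟩
  ∑ (e fz) (𝟙 ∘ q fz)
    ≡⟨ h fz ⟩
  1 ∎
  where
  open ≡-Reasoning
  tails : List ((i : Fin k) → B (fs i))
  tails = depFuns k (B ∘ fs) (e ∘ fs)

anyB-allFin-intro : ∀ {k} (P : Fin k → Bool) j → P j ≡ true → anyB (allFin k) P ≡ true
anyB-allFin-intro P fz e rewrite e = refl
anyB-allFin-intro {suc k} P (fs j) e with P fz
... | true = refl
... | false = trans (cong (λ xs → anyB xs P) (sym (map-tabulate id fs)))
                    (trans (anyB-map fs (allFin k) P) (anyB-allFin-intro (P ∘ fs) j e))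
  where
  anyB-map : {A B : Set} (g : A → B) (xs : List A) (P : B → Bool) → anyB (map g xs) P ≡ anyB xs (P ∘ g)
  anyB-map g [] P = refl
  anyB-map g (x ∷ xs) P = cong (P (g x) ∨_) (anyB-map g xs P)

injective⇒surjective : ∀ {k} (f : Fin k → Fin k) → Injective _≡_ _≡_ f → ∀ y → Σ (Fin k) (λ x → f x ≡ y)
injective⇒surjective {suc k} f f-inj y with Finₚ.any? (λ x → f x Finₚ.≟ y)
... | yes found = found
... | no missed = ⊥-elim (no-collision (Finₚ.pigeonhole (ℕₚ.n<1+n k) (λ x → punchOut (≢y x))))
  where
  ≢y : ∀ x → y ≢ f x
  ≢y x e = missed (x , sym e)
  no-collision : ¬ ∃₂ (λ i j → toℕ i < toℕ j × punchOut (≢y i) ≡ punchOut (≢y j))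
  no-collision (i , j , i<j , same) = Finₚ.<⇒≢ i<j (f-inj (Finₚ.punchOut-injective (≢y i) (≢y j) same))

module Rank {k : ℕ} (h : Fin k → ℕ) where

  below : Fin k → ℕ
  below j = ∑ (allFin k) (λ l → 𝟙 (h l <ᵇ h j))

  below-mono : ∀ {a b} → h a < h b → below a < below b
  below-mono {a} {b} ha<hb = ∑𝟙-<-allFin (λ l → h l <ᵇ h a) (λ l → h l <ᵇ h b)
    (λ l e → <⇒<ᵇ (ℕₚ.<-trans (<ᵇ⇒< e) ha<hb)) a (<⇒<ᵇ ha<hb) (<ᵇ-irrefl (h a))

  below<k : ∀ j → below j < k
  below<k j = subst (below j <_) (∑-allFin-1 k)
    (∑𝟙-<-allFin (λ l → h l <ᵇ h j) (λ _ → true) (λ _ _ → refl) j refl (<ᵇ-irrefl (h j)))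

  rank : Fin k → Fin k
  rank j = fromℕ< (below<k j)

  toℕ-rank : ∀ j → toℕ (rank j) ≡ below j
  toℕ-rank j = Finₚ.toℕ-fromℕ< (below<k j)

  module _ (h-inj : Injective _≡_ _≡_ h) where

    below-reflects-< : ∀ {a b} → below a < below b → h a < h b
    below-reflects-< {a} {b} lt with ℕₚ.<-cmp (h a) (h b)
    ... | tri< ha<hb _ _ = ha<hb
    ... | tri≈ _ ha≡hb _ rewrite h-inj ha≡hb = ⊥-elim (ℕₚ.<-irrefl refl lt)
    ... | tri> _ _ hb<ha = ⊥-elim (ℕₚ.<-asym lt (below-mono hb<ha))

    below-injective : Injective _≡_ _≡_ below
    below-injective {a} {b} e with ℕₚ.<-cmp (h a) (h b)
    ... | tri< ha<hb _ _ = ⊥-elim (ℕₚ.<-irrefl e (below-mono ha<hb))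
    ... | tri≈ _ ha≡hb _ = h-inj ha≡hb
    ... | tri> _ _ hb<ha = ⊥-elim (ℕₚ.<-irrefl (sym e) (below-mono hb<ha))

    module _ {σ : Fin k → Fin k} (σ-rank : ∀ j → toℕ (σ j) ≡ below j) where

      rank-injective : Injective _≡_ _≡_ σ
      rank-injective {a} {b} e = below-injective (trans (sym (σ-rank a)) (trans (cong toℕ e) (σ-rank b)))

      rank-reflects-< : ∀ {a b} → toℕ (σ a) < toℕ (σ b) → h a < h b
      rank-reflects-< {a} {b} lt = below-reflects-< (subst₂ _<_ (σ-rank a) (σ-rank b) lt)

  rank-mono : ∀ {σ : Fin k → Fin k} → (∀ j → toℕ (σ j) ≡ below j) →
              ∀ {a b} → h a < h b → toℕ (σ a) < toℕ (σ b)
  rank-mono σ-rank {a} {b} lt = subst₂ _<_ (sym (σ-rank a)) (sym (σ-rank b)) (below-mono lt)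

injective-below : ∀ {k} (σ : Fin k → Fin k) → Injective _≡_ _≡_ σ →
                  ∀ y → y ≤ k → ∑ (allFin k) (λ l → 𝟙 (toℕ (σ l) <ᵇ y)) ≡ y
injective-below {k} σ σ-inj zero _ = ∑-zero (allFin k) (λ l → cong 𝟙 (not<ᵇ0 (toℕ (σ l))))
  where
  not<ᵇ0 : ∀ v → (v <ᵇ zero) ≡ false
  not<ᵇ0 zero = refl
  not<ᵇ0 (suc v) = refl
injective-below {k} σ σ-inj (suc y) y<k = begin
  ∑ (allFin k) (λ l → 𝟙 (toℕ (σ l) <ᵇ suc y))
    ≡⟨ ∑-cong (allFin k) (λ l → <ᵇ-suc (toℕ (σ l)) y) ⟩
  ∑ (allFin k) (λ l → 𝟙 (toℕ (σ l) <ᵇ y) + 𝟙 (toℕ (σ l) ≡ᵇ y))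
    ≡⟨ ∑-distrib-+ (allFin k) _ _ ⟩
  ∑ (allFin k) (λ l → 𝟙 (toℕ (σ l) <ᵇ y)) + ∑ (allFin k) (λ l → 𝟙 (toℕ (σ l) ≡ᵇ y))
    ≡⟨ cong₂ _+_ (injective-below σ σ-inj y (ℕₚ.<⇒≤ y<k)) hit-once ⟩
  y + 1
    ≡⟨ ℕₚ.+-comm y 1 ⟩
  suc y ∎
  where
  open ≡-Reasoning
  <ᵇ-suc : ∀ v y → 𝟙 (v <ᵇ suc y) ≡ 𝟙 (v <ᵇ y) + 𝟙 (v ≡ᵇ y)
  <ᵇ-suc zero zero = refl
  <ᵇ-suc zero (suc y) = refl
  <ᵇ-suc (suc v) zero = refl
  <ᵇ-suc (suc v) (suc y) = <ᵇ-suc v y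
  preimage : Σ (Fin k) (λ x → σ x ≡ fromℕ< y<k)
  preimage = injective⇒surjective σ σ-inj (fromℕ< y<k)
  x : Fin k
  x = proj₁ preimage
  σx≡y : toℕ (σ x) ≡ y
  σx≡y = trans (cong toℕ (proj₂ preimage)) (Finₚ.toℕ-fromℕ< y<k)
  hit-once : ∑ (allFin k) (λ l → 𝟙 (toℕ (σ l) ≡ᵇ y)) ≡ 1
  hit-once = trans (∑-cong (allFin k) (λ l → cong 𝟙 (Bool-ext
    (λ e → ≡⇒finEq (σ-inj (Finₚ.toℕ-injective (trans (≡ᵇ⇒≡ e) (sym σx≡y)))))
    (λ e → ≡⇒≡ᵇ (trans (cong (toℕ ∘ σ) (finEq⇒≡ e)) σx≡y)))))
    (∑-allFin-finEq x)

rank-unique : ∀ {k} (h : Fin k → ℕ) (σ : Fin k → Fin k) → Injective _≡_ _≡_ σ →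
              (∀ a b → h a < h b → toℕ (σ a) < toℕ (σ b)) →
              (∀ a b → toℕ (σ a) < toℕ (σ b) → h a < h b) →
              ∀ j → toℕ (σ j) ≡ Rank.below h j
rank-unique {k} h σ σ-inj mono reflects j = trans
  (sym (injective-below σ σ-inj (toℕ (σ j)) (ℕₚ.<⇒≤ (Finₚ.toℕ<n (σ j)))))
  (∑-cong (allFin k) (λ l → cong 𝟙 (Bool-ext
    (λ e → <⇒<ᵇ (reflects l j (<ᵇ⇒< e)))
    (λ e → <⇒<ᵇ (mono l j (<ᵇ⇒< e))))))

module _ {k : ℕ} (f : Fin k → Fin k) where

  inv-preimage : ∀ y → Σ (Fin k) (λ x → f x ≡ y) → f (inv f y) ≡ y
  inv-preimage y (x , fx≡y) = search id x fx≡y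
    where
    search : ∀ {r} (g : Fin r → Fin k) j → f (g j) ≡ y → f (findPre f y (tabulate g)) ≡ y
    search g fz e with finEq (f (g fz)) y in hit
    ... | true = finEq⇒≡ hit
    ... | false with () ← trans (sym (≡⇒finEq e)) hit
    search g (fs j) e with finEq (f (g fz)) y in hit
    ... | true = finEq⇒≡ hit
    ... | false = search (g ∘ fs) j e

  module _ (f-inj : Injective _≡_ _≡_ f) where

    inv-inverseˡ : ∀ x → inv f (f x) ≡ x
    inv-inverseˡ x = f-inj (inv-preimage (f x) (x , refl))

    inv-inverseʳ : ∀ y → f (inv f y) ≡ y
    inv-inverseʳ y = inv-preimage y (injective⇒surjective f f-inj y)

    injective⇒isBijB : isBijB f ≡ true
    injective⇒isBijB = ∧-intro
      (allB-intro (allFin k) λ a → allB-intro (allFin k) λ b → ⇒ᵇ-intro (≡⇒finEq ∘ f-inj ∘ finEq⇒≡))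
      (allB-intro (allFin k) λ y → anyB-allFin-intro (λ x → finEq (f x) y) (inv f y) (≡⇒finEq (inv-inverseʳ y)))

  isBijB⇒injective : isBijB f ≡ true → Injective _≡_ _≡_ f
  isBijB⇒injective e {a} {b} fa≡fb =
    finEq⇒≡ (⇒ᵇ-elim (allB-allFin-elim (allB-allFin-elim (∧-elimˡ e) a) b) (≡⇒finEq fa≡fb))

inv-cong : ∀ {k} {f g : Fin k → Fin k} → (∀ x → f x ≡ g x) → ∀ y → inv f y ≡ inv g y
inv-cong {k} {f} {g} f≗g y = go (allFin k)
  where
  go : ∀ xs → findPre f y xs ≡ findPre g y xs
  go [] = refl
  go (x ∷ xs) rewrite f≗g x | go xs = refl

sumIf-Sym : ∀ {k} (p : (Fin k → Fin k) → Bool) (f : (Fin k → Fin k) → ℕ) →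
            sumIf (Sym k) p f ≡ ∑ (finFuns k k) (λ σ → (isBijB σ ∧ p σ) ⊙ f σ)
sumIf-Sym {k} p f = begin
  sumIf (Sym k) p f                                 ≡⟨ sumIf≡∑⊙ (Sym k) p f ⟩
  ∑ (Sym k) (λ σ → p σ ⊙ f σ)                       ≡⟨ ∑-filter isBijB (finFuns k k) _ ⟩
  ∑ (finFuns k k) (λ σ → isBijB σ ⊙ p σ ⊙ f σ)      ≡⟨ ∑-cong (finFuns k k) (λ σ → sym (⊙-∧ (isBijB σ) (p σ) (f σ))) ⟩
  ∑ (finFuns k k) (λ σ → (isBijB σ ∧ p σ) ⊙ f σ)    ∎
  where open ≡-Reasoning

⊙⊙-∑∑𝟙 : ∀ {A B : Set} a b (xs : List A) (ys : List B) (p : A → B → Bool) →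
          a ⊙ b ⊙ ∑ xs (λ x → ∑ ys (λ y → 𝟙 (p x y))) ≡ ∑ xs (λ x → ∑ ys (λ y → 𝟙 (a ∧ b ∧ p x y)))
⊙⊙-∑∑𝟙 true true xs ys p = refl
⊙⊙-∑∑𝟙 true false xs ys p = sym (∑-zero xs (λ x → ∑-zero ys (λ y → refl)))
⊙⊙-∑∑𝟙 false b xs ys p = sym (∑-zero xs (λ x → ∑-zero ys (λ y → refl)))

∑-⊙-unique : ∀ {A : Set} (xs : List A) (p : A → Bool) → ∑ xs (𝟙 ∘ p) ≡ 1 → ∀ a → ∑ xs (λ x → p x ⊙ a) ≡ a
∑-⊙-unique xs p once a = begin
  ∑ xs (λ x → p x ⊙ a)    ≡⟨ ∑-cong xs (λ x → ⊙≡𝟙* (p x)) ⟩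
  ∑ xs (λ x → 𝟙 (p x) * a) ≡⟨ ∑-distribʳ-* xs ⟩
  ∑ xs (𝟙 ∘ p) * a         ≡⟨ cong (_* a) once ⟩
  1 * a                    ≡⟨ ℕₚ.*-identityˡ a ⟩
  a                        ∎
  where
  open ≡-Reasoning
  ⊙≡𝟙* : ∀ b → b ⊙ a ≡ 𝟙 b * a
  ⊙≡𝟙* true = sym (ℕₚ.*-identityˡ a)
  ⊙≡𝟙* false = refl
  ∑-distribʳ-* : ∀ {f} ys → ∑ ys (λ x → f x * a) ≡ ∑ ys f * a
  ∑-distribʳ-* [] = refl
  ∑-distribʳ-* {f} (y ∷ ys) =
    trans (cong (f y * a +_) (∑-distribʳ-* ys)) (sym (ℕₚ.*-distribʳ-+ a (f y) (∑ ys f)))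

∑³𝟙-∧-unique : ∀ {A B C : Set} {xs : List A} {ys : List B} {zs : List C} {p q r} →
               ∑ xs (𝟙 ∘ p) ≡ 1 → ∑ ys (𝟙 ∘ q) ≡ 1 → ∑ zs (𝟙 ∘ r) ≡ 1 →
               ∑ xs (λ x → ∑ ys (λ y → ∑ zs (λ z → 𝟙 (p x ∧ q y ∧ r z)))) ≡ 1
∑³𝟙-∧-unique {xs = xs} {ys} {zs} {p} {q} {r} p-once q-once r-once = begin
  ∑ xs (λ x → ∑ ys (λ y → ∑ zs (λ z → 𝟙 (p x ∧ q y ∧ r z))))
    ≡⟨ ∑-cong xs (λ x → ∑-cong ys (λ y → ∑-cong zs (λ z →
         trans (𝟙-∧ (p x) _) (cong (p x ⊙_) (𝟙-∧ (q y) (r z)))))) ⟩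
  ∑ xs (λ x → ∑ ys (λ y → ∑ zs (λ z → p x ⊙ q y ⊙ 𝟙 (r z))))
    ≡⟨ ∑-cong xs (λ x → ∑-cong ys (λ y →
         trans (∑-cong zs (λ z → sym (⊙-∧ (p x) (q y) _))) (sym (⊙-distrib-∑ (p x ∧ q y) zs _)))) ⟩
  ∑ xs (λ x → ∑ ys (λ y → (p x ∧ q y) ⊙ ∑ zs (𝟙 ∘ r)))
    ≡⟨ ∑-cong xs (λ x → ∑-cong ys (λ y → trans (cong ((p x ∧ q y) ⊙_) r-once) (⊙-∧ (p x) (q y) 1))) ⟩
  ∑ xs (λ x → ∑ ys (λ y → p x ⊙ q y ⊙ 1))
    ≡⟨ ∑-cong xs (λ x → sym (⊙-distrib-∑ (p x) ys _)) ⟩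
  ∑ xs (λ x → p x ⊙ ∑ ys (λ y → q y ⊙ 1))
    ≡⟨ ∑-cong xs (λ x → cong (p x ⊙_) (∑-⊙-unique ys q q-once 1)) ⟩
  ∑ xs (λ x → p x ⊙ 1)
    ≡⟨ ∑-⊙-unique xs p p-once 1 ⟩
  1 ∎
  where open ≡-Reasoning

_≗ᵇ_ : ∀ {k r} → (Fin k → Fin r) → (Fin k → Fin r) → Bool
_≗ᵇ_ {k} f g = allB (allFin k) (λ j → finEq (f j) (g j))

≗ᵇ⇒≗ : ∀ {k r} {f g : Fin k → Fin r} → (f ≗ᵇ g) ≡ true → ∀ j → f j ≡ g j
≗ᵇ⇒≗ e j = finEq⇒≡ (allB-allFin-elim e j)

≗⇒≗ᵇ : ∀ {k r} {f g : Fin k → Fin r} → (∀ j → f j ≡ g j) → (f ≗ᵇ g) ≡ true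
≗⇒≗ᵇ {k} h = allB-intro (allFin k) (≡⇒finEq ∘ h)

∑-finFuns-≗ᵇ : ∀ {k r} (g : Fin k → Fin r) → ∑ (finFuns k r) (λ f → 𝟙 (f ≗ᵇ g)) ≡ 1
∑-finFuns-≗ᵇ {k} {r} g =
  depFuns-unique k (λ _ → Fin r) (λ _ → allFin r) (λ j x → finEq x (g j)) (∑-allFin-finEq ∘ g)

module _ (T : PatternTree) where
  open PatternTree T

  satX-mono : (X X′ : Pt T → ℕ) → (∀ a b → X a < X b → X′ a < X′ b) → satX T X ≡ true → satX T X′ ≡ true
  satX-mono X X′ h e = ∧-intro
    (allB-mono (allFin (suc m)) (λ v → allB-mono (allFin (s v)) λ i → allB-mono (allFin (s v)) λ j →
      ⇒ᵇ-mono (lift (v , i) (v , j))) (∧-elimˡ e))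
    (allB-mono (allFin m) (λ d → allB-mono (sides T d) λ a → allB-mono (sides T d) λ b →
      ⇒ᵇ-mono (lift (emb T d a) (emb T d b))) (∧-elimʳ e))
    where
    lift : ∀ a b → (X a <ᵇ X b) ≡ true → (X′ a <ᵇ X′ b) ≡ true
    lift a b = <⇒<ᵇ ∘ h a b ∘ <ᵇ⇒<

  satY-mono : (Y Y′ : Pt T → ℕ) → (∀ a b → Y a < Y b → Y′ a < Y′ b) → satY T Y ≡ true → satY T Y′ ≡ true
  satY-mono Y Y′ h e = ∧-intro
    (allB-mono (allFin (suc m)) (λ v → allB-mono (allFin (s v)) λ i → allB-mono (allFin (s v)) λ j →
      ⇒ᵇ-mono (lift (v , i) (v , j))) (∧-elimˡ e))
    (allB-mono (allFin m) (λ d → allB-mono (sides T d) λ a → allB-mono (sides T d) λ b →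
      ⇒ᵇ-mono (lift (emb T d a) (emb T d b))) (∧-elimʳ e))
    where
    lift : ∀ a b → (Y a <ᵇ Y b) ≡ true → (Y′ a <ᵇ Y′ b) ≡ true
    lift a b = <⇒<ᵇ ∘ h a b ∘ <ᵇ⇒<

  satEq-mono : (R R′ : Pt T → Pt T → Bool) → (∀ a b → R a b ≡ true → R′ a b ≡ true) →
               satEq T R ≡ true → satEq T R′ ≡ true
  satEq-mono R R′ h = allB-mono (allFin m) λ d → allB-mono (allFin (s (parent d))) λ i →
    allB-mono (allFin (s (fs d))) λ j → ⇒ᵇ-mono (h (parent d , i) (fs d , j))

  validE-cong : (R R′ : Pt T → Pt T → Bool) → (∀ a b → R a b ≡ R′ a b) → validE T R ≡ validE T R′
  validE-cong R R′ h = cong₂ _∧_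
    (cong₂ _∧_ (allB-cong (allPt T) (λ a → h a a))
      (cong₂ _∧_ (allB-cong (allPt T) λ a → allB-cong (allPt T) λ b → cong₂ _⇒ᵇ_ (h a b) (h b a))
         (allB-cong (allPt T) λ a → allB-cong (allPt T) λ b → allB-cong (allPt T) λ c →
           cong₂ _⇒ᵇ_ (cong₂ _∧_ (h a b) (h b c)) (h a c))))
    (allB-cong (allFin m) λ d → allB-cong (allFin (s (parent d))) λ i → allB-cong (allFin (s (fs d))) λ j →
      cong (Eq d i j ⇒ᵇ_) (h (parent d , i) (fs d , j)))

_⇔ᵇ_ : Bool → Bool → Bool
true ⇔ᵇ b = b
false ⇔ᵇ b = not b

⇔ᵇ⇒≡ : ∀ {a b} → (a ⇔ᵇ b) ≡ true → a ≡ b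
⇔ᵇ⇒≡ {true} {true} _ = refl
⇔ᵇ⇒≡ {false} {false} _ = refl

≡⇒⇔ᵇ : ∀ {a b} → a ≡ b → (a ⇔ᵇ b) ≡ true
≡⇒⇔ᵇ {true} refl = refl
≡⇒⇔ᵇ {false} refl = refl

∑-⇔ᵇ-unique : ∀ b → ∑ (true ∷ false ∷ []) (λ x → 𝟙 (x ⇔ᵇ b)) ≡ 1
∑-⇔ᵇ-unique true = refl
∑-⇔ᵇ-unique false = refl

module _ (T : PatternTree) where
  open PatternTree T

  ≡ᵇ-on-isEquivB : (f : Pt T → ℕ) → isEquivB T (λ a b → f a ≡ᵇ f b) ≡ true
  ≡ᵇ-on-isEquivB f = ∧-intro (allB-intro (allPt T) λ a → ≡ᵇ-refl (f a))
    (∧-intro (allB-intro (allPt T) λ a → allB-intro (allPt T) λ b → ⇒ᵇ-intro (symmetric a b))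
             (allB-intro (allPt T) λ a → allB-intro (allPt T) λ b → allB-intro (allPt T) λ d →
                ⇒ᵇ-intro (transitive a b d)))
    where
    symmetric : ∀ a b → (f a ≡ᵇ f b) ≡ true → (f b ≡ᵇ f a) ≡ true
    symmetric a b e = ≡⇒≡ᵇ {f b} (sym (≡ᵇ⇒≡ {f a} e))
    transitive : ∀ a b d → ((f a ≡ᵇ f b) ∧ (f b ≡ᵇ f d)) ≡ true → (f a ≡ᵇ f d) ≡ true
    transitive a b d e =
      ≡⇒≡ᵇ {f a} (trans (≡ᵇ⇒≡ {f a} (∧-elimˡ e)) (≡ᵇ⇒≡ {f b} (∧-elimʳ {f a ≡ᵇ f b} e)))

  samePred : (Pt T → Bool) → (Pt T → Bool) → Bool
  samePred p q = allB (allFin (suc m)) λ w → allB (allFin (s w)) λ j → p (w , j) ⇔ᵇ q (w , j)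

  sameRel : (Pt T → Pt T → Bool) → (Pt T → Pt T → Bool) → Bool
  sameRel E R = allB (allFin (suc m)) λ v → allB (allFin (s v)) λ i → samePred (E (v , i)) (R (v , i))

  sameRel⇒≡ : ∀ E R → sameRel E R ≡ true → ∀ a b → E a b ≡ R a b
  sameRel⇒≡ E R e (v , i) (w , j) =
    ⇔ᵇ⇒≡ (allB-allFin-elim (allB-allFin-elim (allB-allFin-elim (allB-allFin-elim e v) i) w) j)

  ≡⇒sameRel : ∀ E R → (∀ a b → E a b ≡ R a b) → sameRel E R ≡ true
  ≡⇒sameRel E R h = allB-intro (allFin (suc m)) λ v → allB-intro (allFin (s v)) λ i →
    allB-intro (allFin (suc m)) λ w → allB-intro (allFin (s w)) λ j → ≡⇒⇔ᵇ (h (v , i) (w , j))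

  ∑-allRel-sameRel : ∀ R → ∑ (allRel T) (λ E → 𝟙 (sameRel E R)) ≡ 1
  ∑-allRel-sameRel R = trans (∑-map onPt curriedRels (λ E → 𝟙 (sameRel E R)))
    (depFuns-unique (suc m) (λ v → Fin (s v) → Pt T → Bool) (λ v → depFuns (s v) (λ _ → Pt T → Bool) (λ _ → preds))
      (λ v f → allB (allFin (s v)) λ i → samePred (f i) (R (v , i))) λ v →
      depFuns-unique (s v) (λ _ → Pt T → Bool) (λ _ → preds) (λ i p → samePred p (R (v , i))) λ i →
      ∑-preds-samePred (R (v , i)))
    where
    onPt : {B : Set} → ((v : Fin (suc m)) → Fin (s v) → B) → Pt T → B
    onPt f a = f (proj₁ a) (proj₂ a)
    curriedPreds : List ((v : Fin (suc m)) → Fin (s v) → Bool)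
    curriedPreds = depFuns (suc m) (λ v → Fin (s v) → Bool) (λ v → depFuns (s v) (λ _ → Bool) (λ _ → true ∷ false ∷ []))
    preds : List (Pt T → Bool)
    preds = map onPt curriedPreds
    curriedRels : List ((v : Fin (suc m)) → Fin (s v) → Pt T → Bool)
    curriedRels = depFuns (suc m) (λ v → Fin (s v) → Pt T → Bool) (λ v → depFuns (s v) (λ _ → Pt T → Bool) (λ _ → preds))
    ∑-preds-samePred : ∀ q → ∑ preds (λ p → 𝟙 (samePred p q)) ≡ 1
    ∑-preds-samePred q = trans (∑-map onPt curriedPreds (λ p → 𝟙 (samePred p q)))
      (depFuns-unique (suc m) (λ w → Fin (s w) → Bool) (λ w → depFuns (s w) (λ _ → Bool) (λ _ → true ∷ false ∷ []))
        (λ w g → allB (allFin (s w)) λ j → g j ⇔ᵇ q (w , j)) λ w →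
        depFuns-unique (s w) (λ _ → Bool) (λ _ → true ∷ false ∷ []) (λ j x → x ⇔ᵇ q (w , j)) λ j →
        ∑-⇔ᵇ-unique (q (w , j)))

module Counting (T : PatternTree) {n : ℕ} (π : Permutation′ n) where
  open PatternTree T

  π′ : Fin n → Fin n
  π′ x = π ⟨$⟩ʳ x

  π′-injective : Injective _≡_ _≡_ π′
  π′-injective e = trans (sym (inverseˡ π)) (trans (cong (π ⟨$⟩ˡ_) e) (inverseˡ π))

  -- A map p(T) → p(π), recorded through the x-coordinates of the images.
  Placement : Set
  Placement = (v : Fin (suc m)) → Fin (s v) → Fin n

  placements : List Placement
  placements = depFuns (suc m) (λ v → Fin (s v) → Fin n) (λ v → finFuns (s v) n)

  _at_ : Placement → Pt T → Fin n
  φ at a = φ (proj₁ a) (proj₂ a)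

  X : Placement → Pt T → ℕ
  X φ a = toℕ (φ at a)

  Y : Placement → Pt T → ℕ
  Y φ a = toℕ (π′ (φ at a))

  isOccurrence : Placement → Bool
  isOccurrence φ = satX T (X φ) ∧ satY T (Y φ) ∧ satEq T (λ a b → (X φ a ≡ᵇ X φ b) ∧ (Y φ a ≡ᵇ Y φ b))

  -- A point of π is determined by its x-coordinate, so this is the relation "same image".
  kernel : Placement → Pt T → Pt T → Bool
  kernel φ a b = X φ a ≡ᵇ X φ b

  isPatternAt : ∀ {k} → (Fin k → Fin k) → (Fin k → Fin n) → Fin k → Fin k → Bool
  isPatternAt ρ i j l =
    (finLt j l ⇒ᵇ finLt (i j) (i l))
    ∧ ((finLt (π′ (i j)) (π′ (i l)) ⇒ᵇ finLt (ρ j) (ρ l))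
       ∧ (finLt (ρ j) (ρ l) ⇒ᵇ finLt (π′ (i j)) (π′ (i l))))

  isPattern : ∀ {k} → (Fin k → Fin k) → (Fin k → Fin n) → Bool
  isPattern {k} ρ i = allB (allFin k) λ j → allB (allFin k) (isPatternAt ρ i j)

  factors : ∀ {k} → (Pt T → Fin k) → Placement → (Fin k → Fin k) → (Fin k → Fin n) → Bool
  factors c φ σ i = allB (allFin (suc m)) λ v → allB (allFin (s v)) λ j → finEq (φ v j) (i (σ (c (v , j))))

  -- The triple (σ, τ, i) of the inner sum for the classing c induces the placement φ = i ∘ σ ∘ c.
  contributes : ∀ {k} → (Pt T → Fin k) → Placement → (σ τ : Fin k → Fin k) → (Fin k → Fin n) → Bool
  contributes c φ σ τ i =
    (isBijB σ ∧ linExtX T c σ) ∧ (isBijB τ ∧ linExtY T c τ) ∧ isPattern (τ ∘ inv σ) i ∧ factors c φ σ i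

  contributions : (k : ℕ) → (Pt T → Fin k) → Placement → ℕ
  contributions k c φ =
    ∑ (finFuns k k) λ σ → ∑ (finFuns k k) λ τ → ∑ (finFuns k n) λ i → 𝟙 (contributes c φ σ τ i)

  ∑-placements-factors : ∀ {k} (c : Pt T → Fin k) σ i → ∑ placements (λ φ → 𝟙 (factors c φ σ i)) ≡ 1
  ∑-placements-factors c σ i =
    depFuns-unique (suc m) (λ v → Fin (s v) → Fin n) (λ v → finFuns (s v) n)
      (λ v g → allB (allFin (s v)) λ j → finEq (g j) (i (σ (c (v , j))))) λ v →
      depFuns-unique (s v) (λ _ → Fin n) (λ _ → allFin n) (λ j x → finEq x (i (σ (c (v , j))))) λ j →
      ∑-allFin-finEq (i (σ (c (v , j))))

  occ-by-placements : ∀ {k} (c : Pt T → Fin k) σ ρ →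
    occ ρ π′ ≡ ∑ placements (λ φ → ∑ (finFuns k n) (λ i → 𝟙 (isPattern ρ i ∧ factors c φ σ i)))
  occ-by-placements {k} c σ ρ = begin
    occ ρ π′
      ≡⟨ count≡∑𝟙 (finFuns k n) (isPattern ρ) ⟩
    ∑ (finFuns k n) (λ i → 𝟙 (isPattern ρ i))
      ≡⟨ ∑-cong (finFuns k n) (λ i → sym (trans (cong (isPattern ρ i ⊙_) (∑-placements-factors c σ i))
                                                (⊙-1 (isPattern ρ i)))) ⟩
    ∑ (finFuns k n) (λ i → isPattern ρ i ⊙ ∑ placements (λ φ → 𝟙 (factors c φ σ i)))
      ≡⟨ ∑-cong (finFuns k n) (λ i → trans (⊙-distrib-∑ (isPattern ρ i) placements _)
                                           (∑-cong placements λ φ → sym (𝟙-∧ (isPattern ρ i) _))) ⟩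
    ∑ (finFuns k n) (λ i → ∑ placements (λ φ → 𝟙 (isPattern ρ i ∧ factors c φ σ i)))
      ≡⟨ ∑-comm (finFuns k n) placements _ ⟩
    ∑ placements (λ φ → ∑ (finFuns k n) (λ i → 𝟙 (isPattern ρ i ∧ factors c φ σ i))) ∎
    where open ≡-Reasoning

  innerSum≡∑contributions : ∀ k (c : Pt T → Fin k) → innerSum T π (k , c) ≡ ∑ placements (contributions k c)
  innerSum≡∑contributions k c = begin
    innerSum T π (k , c)
      ≡⟨ sumIf-Sym (linExtX T c) _ ⟩
    ∑ Fs (λ σ → Bσ σ ⊙ sumIf (Sym k) (linExtY T c) (λ τ → occ (τ ∘ inv σ) π′))
      ≡⟨ ∑-cong Fs (λ σ → cong (Bσ σ ⊙_) (sumIf-Sym (linExtY T c) _)) ⟩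
    ∑ Fs (λ σ → Bσ σ ⊙ ∑ Fs (λ τ → Bτ τ ⊙ occ (τ ∘ inv σ) π′))
      ≡⟨ ∑-cong Fs (λ σ → cong (Bσ σ ⊙_) (∑-cong Fs λ τ → cong (Bτ τ ⊙_) (occ-by-placements c σ (τ ∘ inv σ)))) ⟩
    ∑ Fs (λ σ → Bσ σ ⊙ ∑ Fs (λ τ → Bτ τ ⊙ ∑ placements (λ φ → ∑ Is (λ i → 𝟙 (P σ τ φ i)))))
      ≡⟨ ∑-cong Fs (λ σ → trans (⊙-distrib-∑ (Bσ σ) Fs _)
           (∑-cong Fs λ τ → ⊙⊙-∑∑𝟙 (Bσ σ) (Bτ τ) placements Is (P σ τ))) ⟩
    ∑ Fs (λ σ → ∑ Fs (λ τ → ∑ placements (λ φ → ∑ Is (λ i → 𝟙 (contributes c φ σ τ i)))))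
      ≡⟨ ∑-cong Fs (λ σ → ∑-comm Fs placements _) ⟩
    ∑ Fs (λ σ → ∑ placements (λ φ → ∑ Fs (λ τ → ∑ Is (λ i → 𝟙 (contributes c φ σ τ i)))))
      ≡⟨ ∑-comm Fs placements _ ⟩
    ∑ placements (contributions k c) ∎
    where
    open ≡-Reasoning
    Fs : List (Fin k → Fin k)
    Fs = finFuns k k
    Is : List (Fin k → Fin n)
    Is = finFuns k n
    Bσ Bτ : (Fin k → Fin k) → Bool
    Bσ σ = isBijB σ ∧ linExtX T c σ
    Bτ τ = isBijB τ ∧ linExtY T c τ
    P : (σ τ : Fin k → Fin k) → Placement → (Fin k → Fin n) → Bool
    P σ τ φ i = isPattern (τ ∘ inv σ) i ∧ factors c φ σ i

  module Pattern {k} {ρ : Fin k → Fin k} {i : Fin k → Fin n} (pat : isPattern ρ i ≡ true) where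

    private
      at : ∀ j l → isPatternAt ρ i j l ≡ true
      at j = allB-allFin-elim (allB-allFin-elim pat j)

    increasing : ∀ {j l} → toℕ j < toℕ l → toℕ (i j) < toℕ (i l)
    increasing {j} {l} = <ᵇ⇒< ∘ ⇒ᵇ-elim {finLt j l} (∧-elimˡ (at j l)) ∘ <⇒<ᵇ

    ρ<⇒π< : ∀ {j l} → toℕ (ρ j) < toℕ (ρ l) → toℕ (π′ (i j)) < toℕ (π′ (i l))
    ρ<⇒π< {j} {l} = <ᵇ⇒< ∘ ⇒ᵇ-elim {finLt (ρ j) (ρ l)}
      (∧-elimʳ {finLt (π′ (i j)) (π′ (i l)) ⇒ᵇ finLt (ρ j) (ρ l)}
        (∧-elimʳ {finLt j l ⇒ᵇ finLt (i j) (i l)} (at j l))) ∘ <⇒<ᵇ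

    π<⇒ρ< : ∀ {j l} → toℕ (π′ (i j)) < toℕ (π′ (i l)) → toℕ (ρ j) < toℕ (ρ l)
    π<⇒ρ< {j} {l} = <ᵇ⇒< ∘ ⇒ᵇ-elim {finLt (π′ (i j)) (π′ (i l))}
      (∧-elimˡ (∧-elimʳ {finLt j l ⇒ᵇ finLt (i j) (i l)} (at j l))) ∘ <⇒<ᵇ

    reflects-< : ∀ {j l} → toℕ (i j) < toℕ (i l) → toℕ j < toℕ l
    reflects-< {j} {l} lt with ℕₚ.<-cmp (toℕ j) (toℕ l)
    ... | tri< j<l _ _ = j<l
    ... | tri≈ _ j≡l _ rewrite Finₚ.toℕ-injective j≡l = ⊥-elim (ℕₚ.<-irrefl refl lt)
    ... | tri> _ _ l<j = ⊥-elim (ℕₚ.<-asym lt (increasing l<j))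

    injective : Injective _≡_ _≡_ i
    injective {j} {l} e with ℕₚ.<-cmp (toℕ j) (toℕ l)
    ... | tri< j<l _ _ = ⊥-elim (ℕₚ.<-irrefl (cong toℕ e) (increasing j<l))
    ... | tri≈ _ j≡l _ = Finₚ.toℕ-injective j≡l
    ... | tri> _ _ l<j = ⊥-elim (ℕₚ.<-irrefl (cong toℕ (sym e)) (increasing l<j))

  isPattern-intro : ∀ {k} {ρ : Fin k → Fin k} {i : Fin k → Fin n} →
    (∀ j l → toℕ j < toℕ l → toℕ (i j) < toℕ (i l)) →
    (∀ j l → toℕ (ρ j) < toℕ (ρ l) → toℕ (π′ (i j)) < toℕ (π′ (i l))) →
    (∀ j l → toℕ (π′ (i j)) < toℕ (π′ (i l)) → toℕ (ρ j) < toℕ (ρ l)) →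
    isPattern ρ i ≡ true
  isPattern-intro {k} incr ρ⇒π π⇒ρ = allB-intro (allFin k) λ j → allB-intro (allFin k) λ l →
    ∧-intro (⇒ᵇ-intro (<⇒<ᵇ ∘ incr j l ∘ <ᵇ⇒<))
            (∧-intro (⇒ᵇ-intro (<⇒<ᵇ ∘ π⇒ρ j l ∘ <ᵇ⇒<))
                     (⇒ᵇ-intro (<⇒<ᵇ ∘ ρ⇒π j l ∘ <ᵇ⇒<)))

  module Classed (φ : Placement) (E : Pt T → Pt T → Bool) {k} (c : Pt T → Fin k)
                 (c-classes : IsClassing T E (k , c)) where

    c≡⇒E : ∀ a b → c a ≡ c b → E a b ≡ true
    c≡⇒E a b = Equivalence.to (proj₂ c-classes a b)

    E⇒c≡ : ∀ a b → E a b ≡ true → c a ≡ c b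
    E⇒c≡ a b = Equivalence.from (proj₂ c-classes a b)

    module Contribution {σ τ : Fin k → Fin k} {i : Fin k → Fin n} (t : contributes c φ σ τ i ≡ true) where

      private
        σ-part : (isBijB σ ∧ linExtX T c σ) ≡ true
        σ-part = ∧-elimˡ t
        τ-part,rest : ((isBijB τ ∧ linExtY T c τ) ∧ isPattern (τ ∘ inv σ) i ∧ factors c φ σ i) ≡ true
        τ-part,rest = ∧-elimʳ {isBijB σ ∧ linExtX T c σ} t
        τ-part : (isBijB τ ∧ linExtY T c τ) ≡ true
        τ-part = ∧-elimˡ τ-part,rest
        rest : (isPattern (τ ∘ inv σ) i ∧ factors c φ σ i) ≡ true
        rest = ∧-elimʳ {isBijB τ ∧ linExtY T c τ} τ-part,rest

      σ-injective : Injective _≡_ _≡_ σ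
      σ-injective = isBijB⇒injective σ (∧-elimˡ σ-part)

      σ-linExt : linExtX T c σ ≡ true
      σ-linExt = ∧-elimʳ {isBijB σ} σ-part

      τ-injective : Injective _≡_ _≡_ τ
      τ-injective = isBijB⇒injective τ (∧-elimˡ τ-part)

      τ-linExt : linExtY T c τ ≡ true
      τ-linExt = ∧-elimʳ {isBijB τ} τ-part

      open Pattern {ρ = τ ∘ inv σ} {i} (∧-elimˡ rest) public

      φ≡iσc : ∀ a → φ at a ≡ i (σ (c a))
      φ≡iσc (v , j) = finEq⇒≡ (allB-allFin-elim (allB-allFin-elim (∧-elimʳ {isPattern (τ ∘ inv σ) i} rest) v) j)

      isOccurrence-φ : satEq T E ≡ true → isOccurrence φ ≡ true
      isOccurrence-φ E-generated = ∧-intro (satX-mono T (λ a → toℕ (σ (c a))) (X φ) x-mono σ-linExt)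
        (∧-intro (satY-mono T (λ a → toℕ (τ (c a))) (Y φ) y-mono τ-linExt) (satEq-mono T E _ E⇒same E-generated))
        where
        x-mono : ∀ a b → toℕ (σ (c a)) < toℕ (σ (c b)) → X φ a < X φ b
        x-mono a b lt rewrite φ≡iσc a | φ≡iσc b = increasing lt
        y-mono : ∀ a b → toℕ (τ (c a)) < toℕ (τ (c b)) → Y φ a < Y φ b
        y-mono a b lt rewrite φ≡iσc a | φ≡iσc b = ρ<⇒π< (subst₂ (λ u v → toℕ (τ u) < toℕ (τ v))
          (sym (inv-inverseˡ σ σ-injective (c a))) (sym (inv-inverseˡ σ σ-injective (c b))) lt)
        E⇒same : ∀ a b → E a b ≡ true → ((X φ a ≡ᵇ X φ b) ∧ (Y φ a ≡ᵇ Y φ b)) ≡ true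
        E⇒same a b e rewrite φ≡iσc a | φ≡iσc b | E⇒c≡ a b e =
          ∧-intro (≡ᵇ-refl (toℕ (i (σ (c b))))) (≡ᵇ-refl (toℕ (π′ (i (σ (c b))))))

      E-is-kernel : sameRel T E (kernel φ) ≡ true
      E-is-kernel = ≡⇒sameRel T E (kernel φ) λ a b → Bool-ext (E⇒kernel a b) (kernel⇒E a b)
        where
        E⇒kernel : ∀ a b → E a b ≡ true → kernel φ a b ≡ true
        E⇒kernel a b e rewrite φ≡iσc a | φ≡iσc b | E⇒c≡ a b e = ≡ᵇ-refl (toℕ (i (σ (c b))))
        kernel⇒E : ∀ a b → kernel φ a b ≡ true → E a b ≡ true
        kernel⇒E a b e =
          c≡⇒E a b (σ-injective (injective (trans (sym (φ≡iσc a)) (trans (finEq⇒≡ e) (φ≡iσc b)))))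

    module Canonical (φ-occ : isOccurrence φ ≡ true) (E≡kernel : ∀ a b → E a b ≡ kernel φ a b) where

      rep : Fin k → Pt T
      rep j = proj₁ (proj₁ c-classes j)

      c-rep : ∀ j → c (rep j) ≡ j
      c-rep j = proj₂ (proj₁ c-classes j)

      H : Fin k → Fin n
      H j = φ at rep j

      hX hY : Fin k → ℕ
      hX j = toℕ (H j)
      hY j = toℕ (π′ (H j))

      φ≡Hc : ∀ a → φ at a ≡ H (c a)
      φ≡Hc a = finEq⇒≡ (trans (sym (E≡kernel a (rep (c a)))) (c≡⇒E a (rep (c a)) (sym (c-rep (c a)))))

      hX-injective : Injective _≡_ _≡_ hX
      hX-injective {j} {l} e =
        trans (sym (c-rep j)) (trans (E⇒c≡ (rep j) (rep l) (trans (E≡kernel (rep j) (rep l)) (≡⇒≡ᵇ e))) (c-rep l))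

      hY-injective : Injective _≡_ _≡_ hY
      hY-injective e = hX-injective (cong toℕ (π′-injective (Finₚ.toℕ-injective e)))

      module RX = Rank hX
      module RY = Rank hY

      -- The only contributing triple: σ₀ and τ₀ rank the classes by the x- and y-coordinates of their
      -- images, and i₀ lists these images from left to right.
      σ₀ τ₀ : Fin k → Fin k
      σ₀ = RX.rank
      τ₀ = RY.rank

      i₀ : Fin k → Fin n
      i₀ = H ∘ inv σ₀

      contributes⇒canonical : ∀ {σ τ i} → contributes c φ σ τ i ≡ true →
                              (∀ j → σ j ≡ σ₀ j) × (∀ j → τ j ≡ τ₀ j) × (∀ x → i x ≡ i₀ x)
      contributes⇒canonical {σ} {τ} {i} t =
        σ≗σ₀ , τ≗τ₀ , λ x → trans (i≡Hσ⁻¹ x) (cong H (inv-cong σ≗σ₀ x))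
        where
        open Contribution {σ} {τ} {i} t
        H≡iσ : ∀ j → H j ≡ i (σ j)
        H≡iσ j = trans (φ≡iσc (rep j)) (cong (i ∘ σ) (c-rep j))
        <-via-H : ∀ {a b} → toℕ (i (σ a)) < toℕ (i (σ b)) → hX a < hX b
        <-via-H {a} {b} = subst₂ (λ u v → toℕ u < toℕ v) (sym (H≡iσ a)) (sym (H≡iσ b))
        π<-via-H : ∀ {a b} → hY a < hY b → toℕ (π′ (i (σ a))) < toℕ (π′ (i (σ b)))
        π<-via-H {a} {b} = subst₂ (λ u v → toℕ (π′ u) < toℕ (π′ v)) (H≡iσ a) (H≡iσ b)
        τσ⁻¹σ : ∀ {a b} → toℕ (τ (inv σ (σ a))) < toℕ (τ (inv σ (σ b))) → toℕ (τ a) < toℕ (τ b)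
        τσ⁻¹σ {a} {b} =
          subst₂ (λ u v → toℕ (τ u) < toℕ (τ v)) (inv-inverseˡ σ σ-injective a) (inv-inverseˡ σ σ-injective b)
        σ≗σ₀ : ∀ j → σ j ≡ σ₀ j
        σ≗σ₀ j = Finₚ.toℕ-injective (trans
          (rank-unique hX σ σ-injective
            (λ a b lt → reflects-< (subst₂ (λ u v → toℕ u < toℕ v) (H≡iσ a) (H≡iσ b) lt))
            (λ a b → <-via-H ∘ increasing) j)
          (sym (RX.toℕ-rank j)))
        τ≗τ₀ : ∀ j → τ j ≡ τ₀ j
        τ≗τ₀ j = Finₚ.toℕ-injective (trans
          (rank-unique hY τ τ-injective
            (λ a b → τσ⁻¹σ ∘ π<⇒ρ< ∘ π<-via-H)
            (λ a b lt → subst₂ _<_ (cong toℕ (cong π′ (sym (H≡iσ a)))) (cong toℕ (cong π′ (sym (H≡iσ b))))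
                          (ρ<⇒π< (subst₂ (λ u v → toℕ (τ u) < toℕ (τ v))
                            (sym (inv-inverseˡ σ σ-injective a)) (sym (inv-inverseˡ σ σ-injective b)) lt))) j)
          (sym (RY.toℕ-rank j)))
        i≡Hσ⁻¹ : ∀ x → i x ≡ H (inv σ x)
        i≡Hσ⁻¹ x = sym (trans (H≡iσ (inv σ x)) (cong i (inv-inverseʳ σ σ-injective x)))

      canonical⇒contributes : ∀ {σ τ i} → (∀ j → σ j ≡ σ₀ j) → (∀ j → τ j ≡ τ₀ j) → (∀ x → i x ≡ i₀ x) →
                              contributes c φ σ τ i ≡ true
      canonical⇒contributes {σ} {τ} {i} σ≗σ₀ τ≗τ₀ i≗i₀ =
        ∧-intro (∧-intro (injective⇒isBijB σ σ-injective) σ-linExt)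
          (∧-intro (∧-intro (injective⇒isBijB τ τ-injective) τ-linExt) (∧-intro τσ⁻¹-pattern factorization))
        where
        σ-rank : ∀ j → toℕ (σ j) ≡ RX.below j
        σ-rank j = trans (cong toℕ (σ≗σ₀ j)) (RX.toℕ-rank j)
        τ-rank : ∀ j → toℕ (τ j) ≡ RY.below j
        τ-rank j = trans (cong toℕ (τ≗τ₀ j)) (RY.toℕ-rank j)
        σ-injective : Injective _≡_ _≡_ σ
        σ-injective = RX.rank-injective hX-injective σ-rank
        τ-injective : Injective _≡_ _≡_ τ
        τ-injective = RY.rank-injective hY-injective τ-rank
        i≡Hσ⁻¹ : ∀ x → i x ≡ H (inv σ x)
        i≡Hσ⁻¹ x = trans (i≗i₀ x) (cong H (sym (inv-cong σ≗σ₀ x)))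
        σσ⁻¹ : ∀ x → σ (inv σ x) ≡ x
        σσ⁻¹ = inv-inverseʳ σ σ-injective
        σ-linExt : linExtX T c σ ≡ true
        σ-linExt = satX-mono T (X φ) (λ a → toℕ (σ (c a)))
          (λ a b lt → RX.rank-mono σ-rank (subst₂ _<_ (cong toℕ (φ≡Hc a)) (cong toℕ (φ≡Hc b)) lt)) (∧-elimˡ φ-occ)
        τ-linExt : linExtY T c τ ≡ true
        τ-linExt = satY-mono T (Y φ) (λ a → toℕ (τ (c a)))
          (λ a b lt → RY.rank-mono τ-rank (subst₂ _<_ (cong (toℕ ∘ π′) (φ≡Hc a)) (cong (toℕ ∘ π′) (φ≡Hc b)) lt))
          (∧-elimˡ (∧-elimʳ {satX T (X φ)} φ-occ))
        τσ⁻¹-pattern : isPattern (τ ∘ inv σ) i ≡ true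
        τσ⁻¹-pattern = isPattern-intro
          (λ j l lt → subst₂ _<_ (cong toℕ (sym (i≡Hσ⁻¹ j))) (cong toℕ (sym (i≡Hσ⁻¹ l)))
            (RX.rank-reflects-< hX-injective σ-rank
              (subst₂ (λ u v → toℕ u < toℕ v) (sym (σσ⁻¹ j)) (sym (σσ⁻¹ l)) lt)))
          (λ j l lt → subst₂ _<_ (cong (toℕ ∘ π′) (sym (i≡Hσ⁻¹ j))) (cong (toℕ ∘ π′) (sym (i≡Hσ⁻¹ l)))
            (RY.rank-reflects-< hY-injective τ-rank lt))
          (λ j l lt → RY.rank-mono τ-rank
            (subst₂ _<_ (cong (toℕ ∘ π′) (i≡Hσ⁻¹ j)) (cong (toℕ ∘ π′) (i≡Hσ⁻¹ l)) lt))
        factorization : factors c φ σ i ≡ true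
        factorization = allB-intro (allFin (suc m)) λ v → allB-intro (allFin (s v)) λ j → ≡⇒finEq (begin
          φ at (v , j)                   ≡⟨ φ≡Hc (v , j) ⟩
          H (c (v , j))                  ≡⟨ cong H (sym (inv-inverseˡ σ σ-injective (c (v , j)))) ⟩
          H (inv σ (σ (c (v , j))))      ≡⟨ sym (i≡Hσ⁻¹ (σ (c (v , j)))) ⟩
          i (σ (c (v , j)))              ∎)
          where open ≡-Reasoning

      contributes≡canonical : ∀ σ τ i → contributes c φ σ τ i ≡ (σ ≗ᵇ σ₀) ∧ (τ ≗ᵇ τ₀) ∧ (i ≗ᵇ i₀)
      contributes≡canonical σ τ i = Bool-ext
        (λ t → let σ≗ , τ≗ , i≗ = contributes⇒canonical {σ} {τ} {i} t
               in ∧-intro (≗⇒≗ᵇ σ≗) (∧-intro (≗⇒≗ᵇ τ≗) (≗⇒≗ᵇ i≗)))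
        (λ e → canonical⇒contributes {σ} {τ} {i} (≗ᵇ⇒≗ (∧-elimˡ e)) (≗ᵇ⇒≗ (∧-elimˡ (∧-elimʳ {σ ≗ᵇ σ₀} e)))
                                     (≗ᵇ⇒≗ (∧-elimʳ {τ ≗ᵇ τ₀} (∧-elimʳ {σ ≗ᵇ σ₀} e))))

      contributions≡1 : contributions k c φ ≡ 1
      contributions≡1 = trans
        (∑-cong (finFuns k k) λ σ → ∑-cong (finFuns k k) λ τ → ∑-cong (finFuns k n) λ i →
          cong 𝟙 (contributes≡canonical σ τ i))
        (∑³𝟙-∧-unique {xs = finFuns k k} {finFuns k k} {finFuns k n} {_≗ᵇ σ₀} {_≗ᵇ τ₀} {_≗ᵇ i₀}
          (∑-finFuns-≗ᵇ σ₀) (∑-finFuns-≗ᵇ τ₀) (∑-finFuns-≗ᵇ i₀))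

    contributions≡0 : satEq T E ≡ true → (isOccurrence φ ∧ sameRel T E (kernel φ)) ≡ false →
                      contributions k c φ ≡ 0
    contributions≡0 E-generated not-kernel =
      ∑-zero (finFuns k k) λ σ → ∑-zero (finFuns k k) λ τ → ∑-zero (finFuns k n) λ i → no-contribution σ τ i
      where
      no-contribution : ∀ σ τ i → 𝟙 (contributes c φ σ τ i) ≡ 0
      no-contribution σ τ i with contributes c φ σ τ i in t
      ... | false = refl
      ... | true with () ← trans (sym not-kernel)
                             (∧-intro (Contribution.isOccurrence-φ {σ} {τ} {i} t E-generated)
                                      (Contribution.E-is-kernel {σ} {τ} {i} t))

  kernel-valid : ∀ φ → isOccurrence φ ≡ true → validE T (kernel φ) ≡ true
  kernel-valid φ φ-occ = ∧-intro (≡ᵇ-on-isEquivB T (X φ))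
    (satEq-mono T (λ a b → (X φ a ≡ᵇ X φ b) ∧ (Y φ a ≡ᵇ Y φ b)) (kernel φ) (λ a b → ∧-elimˡ)
      (∧-elimʳ {satY T (Y φ)} (∧-elimʳ {satX T (X φ)} φ-occ)))

  module _ (cls : (Pt T → Pt T → Bool) → Σ ℕ (λ k → Pt T → Fin k))
           (cls-classes : (E : Pt T → Pt T → Bool) → validE T E ≡ true → IsClassing T E (cls E)) where

    contributionsOf : (Pt T → Pt T → Bool) → Placement → ℕ
    contributionsOf E = contributions (proj₁ (cls E)) (proj₂ (cls E))

    contributions-indicator : ∀ φ E →
      validE T E ⊙ contributionsOf E φ ≡ 𝟙 (isOccurrence φ ∧ sameRel T E (kernel φ))
    contributions-indicator φ E with validE T E in E-valid | isOccurrence φ ∧ sameRel T E (kernel φ) in is-kernel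
    ... | true | true =
      Canonical.contributions≡1 (∧-elimˡ is-kernel) (sameRel⇒≡ T E (kernel φ) (∧-elimʳ {isOccurrence φ} is-kernel))
      where open Classed φ E (proj₂ (cls E)) (cls-classes E E-valid)
    ... | true | false = contributions≡0 (∧-elimʳ {isEquivB T E} E-valid) is-kernel
      where open Classed φ E (proj₂ (cls E)) (cls-classes E E-valid)
    ... | false | false = refl
    ... | false | true with () ← trans (sym E-valid) (trans
          (validE-cong T E (kernel φ) (sameRel⇒≡ T E (kernel φ) (∧-elimʳ {isOccurrence φ} is-kernel)))
          (kernel-valid φ (∧-elimˡ is-kernel)))

    occT≡∑innerSum : occT T π ≡ ∑ (allRel T) (λ E → validE T E ⊙ innerSum T π (cls E))
    occT≡∑innerSum = begin
      occT T π
        ≡⟨ count≡∑𝟙 placements isOccurrence ⟩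
      ∑ placements (𝟙 ∘ isOccurrence)
        ≡⟨ ∑-cong placements (λ φ → sym (occurrence-once φ)) ⟩
      ∑ placements (λ φ → ∑ (allRel T) (λ E → validE T E ⊙ contributionsOf E φ))
        ≡⟨ ∑-comm placements (allRel T) _ ⟩
      ∑ (allRel T) (λ E → ∑ placements (λ φ → validE T E ⊙ contributionsOf E φ))
        ≡⟨ ∑-cong (allRel T) (λ E → sym (⊙-distrib-∑ (validE T E) placements _)) ⟩
      ∑ (allRel T) (λ E → validE T E ⊙ ∑ placements (contributionsOf E))
        ≡⟨ ∑-cong (allRel T) (λ E →
             cong (validE T E ⊙_) (sym (innerSum≡∑contributions (proj₁ (cls E)) (proj₂ (cls E))))) ⟩
      ∑ (allRel T) (λ E → validE T E ⊙ innerSum T π (cls E)) ∎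
      where
      open ≡-Reasoning
      occurrence-once : ∀ φ → ∑ (allRel T) (λ E → validE T E ⊙ contributionsOf E φ) ≡ 𝟙 (isOccurrence φ)
      occurrence-once φ = begin
        ∑ (allRel T) (λ E → validE T E ⊙ contributionsOf E φ)
          ≡⟨ ∑-cong (allRel T) (λ E → trans (contributions-indicator φ E) (𝟙-∧ (isOccurrence φ) _)) ⟩
        ∑ (allRel T) (λ E → isOccurrence φ ⊙ 𝟙 (sameRel T E (kernel φ)))
          ≡⟨ sym (⊙-distrib-∑ (isOccurrence φ) (allRel T) _) ⟩
        isOccurrence φ ⊙ ∑ (allRel T) (λ E → 𝟙 (sameRel T E (kernel φ)))
          ≡⟨ cong (isOccurrence φ ⊙_) (∑-allRel-sameRel T (kernel φ)) ⟩
        isOccurrence φ ⊙ 1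
          ≡⟨ ⊙-1 (isOccurrence φ) ⟩
        𝟙 (isOccurrence φ) ∎

module _ (T : PatternTree) where
  open PatternTree T

  ∑-allPt : (f : Pt T → ℕ) → ∑ (allPt T) f ≡ ∑ (allFin (suc m)) (λ v → ∑ (allFin (s v)) (λ i → f (v , i)))
  ∑-allPt f = trans (∑-concatMap (λ v → map (v ,_) (allFin (s v))) (allFin (suc m)) f)
                    (∑-cong (allFin (suc m)) λ v → ∑-map (v ,_) (allFin (s v)) f)

  ∑-allPt-≥ : (f : Pt T → ℕ) → ∀ a → f a ≤ ∑ (allPt T) f
  ∑-allPt-≥ f (v , i) = begin
    f (v , i)                                                      ≤⟨ ∑-allFin-≥ (λ i → f (v , i)) i ⟩
    ∑ (allFin (s v)) (λ i → f (v , i))                             ≤⟨ ∑-allFin-≥ (λ v → ∑ (allFin (s v)) (λ i → f (v , i))) v ⟩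
    ∑ (allFin (suc m)) (λ v → ∑ (allFin (s v)) (λ i → f (v , i)))  ≡⟨ sym (∑-allPt f) ⟩
    ∑ (allPt T) f                                                  ∎
    where open ℕₚ.≤-Reasoning

  ∑-allPt-1 : ∑ (allPt T) (λ _ → 1) ≡ ΣT T
  ∑-allPt-1 = trans (∑-allPt (λ _ → 1))
    (trans (∑-cong (allFin (suc m)) (∑-allFin-1 ∘ s)) (sym (sum-map s (allFin (suc m)))))
    where
    sum-map : {A : Set} (f : A → ℕ) (xs : List A) → sum (map f xs) ≡ ∑ xs f
    sum-map f [] = refl
    sum-map f (x ∷ xs) = cong (f x +_) (sum-map f xs)

  surjective⇒≤ΣT : ∀ {k} (c : Pt T → Fin k) → (∀ y → Σ (Pt T) (λ a → c a ≡ y)) → k ≤ ΣT T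
  surjective⇒≤ΣT {k} c c-surjective = begin
    k                                                            ≡⟨ sym (∑-allFin-1 k) ⟩
    ∑ (allFin k) (λ _ → 1)                                       ≤⟨ ∑-mono (allFin k) hit ⟩
    ∑ (allFin k) (λ y → ∑ (allPt T) (λ a → 𝟙 (finEq y (c a))))   ≡⟨ ∑-comm (allFin k) (allPt T) _ ⟩
    ∑ (allPt T) (λ a → ∑ (allFin k) (λ y → 𝟙 (finEq y (c a))))   ≡⟨ ∑-cong (allPt T) (∑-allFin-finEq ∘ c) ⟩
    ∑ (allPt T) (λ _ → 1)                                        ≡⟨ ∑-allPt-1 ⟩
    ΣT T                                                         ∎
    where
    open ℕₚ.≤-Reasoning
    hit : ∀ y → 1 ≤ ∑ (allPt T) (λ a → 𝟙 (finEq y (c a)))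
    hit y with a , ca≡y ← c-surjective y =
      ℕₚ.≤-trans (ℕₚ.≤-reflexive (cong 𝟙 (sym (≡⇒finEq (sym ca≡y))))) (∑-allPt-≥ (λ a → 𝟙 (finEq y (c a))) a)

lemma3p5 : (T : PatternTree) (n : ℕ) (π : Permutation′ n)
    → (cls : (Pt T → Pt T → Bool) → Σ ℕ (λ k → Pt T → Fin k))
    → ((E : Pt T → Pt T → Bool) → validE T E ≡ true → IsClassing T E (cls E))
    → (occT T π ≡ sumIf (allRel T) (validE T) (λ E → innerSum T π (cls E)))
    × ((E : Pt T → Pt T → Bool) → validE T E ≡ true → proj₁ (cls E) ≤ ΣT T)
lemma3p5 T n π cls cls-classes =
  counting , λ E E-valid → surjective⇒≤ΣT T (proj₂ (cls E)) (proj₁ (cls-classes E E-valid))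
  where
  counting : occT T π ≡ sumIf (allRel T) (validE T) (λ E → innerSum T π (cls E))
  counting = trans (Counting.occT≡∑innerSum T π cls cls-classes) (sym (sumIf≡∑⊙ (allRel T) (validE T) _))
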